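{- Let $G$ be a finite simple graph and let $e=uv$ be a cut-edge of $G$. Then \begin{align*} J(G)&=J(G-e)+(y-1)\,J\bigl(G-e \mid u\in W,\ N_{G-e}[v]\cap W=\emptyset\bigr)\\ &\quad+(y-1)\,J\bigl(G-e\mid N_{G-e}[u]\cap W=\emptyset,\ v\in W\bigr). \end{align*}
   Context: For a finite simple graph $H$ and $W\subseteq V(H)$, $N_H[W]$ is the set of vertices that are in $W$ or adjacent to a vertex of $W$, and $N_H(W):=N_H[W]\setminus W$; for a vertex $a$, $N_H[a]$ is $a$ together with its neighbours in $H$. The bivariate domination polynomial is $J(H;x,y)=J(H):=\sum_{W\subseteq V(H)} x^{|W|}y^{|N_H(W)|}$. For a condition $c(W)$ on subsets $W\subseteq V(H)$, $J(H\mid c(W))$ is the same sum taken only over those $W$ satisfying $c(W)$. $G-e$ is the graph obtained from $G$ by deleting the edge $e$ (keeping its endpoints). A cut-edge is an edge whose deletion increases the number of connected components. -}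

module Defs where

open import Level using (Level)
open import Data.Nat using (ℕ; zero; suc; _<_)
open import Data.Bool using (Bool; true; false; _∧_; _∨_; not; if_then_else_)
open import Data.Fin using (Fin; zero; suc)
open import Data.Fin.Properties using (_≟_)
open import Data.List using (List; []; _∷_; _++_; map; concatMap; filterᵇ; foldr)
open import Data.Product using (_×_)
open import Relation.Nullary.Decidable using (⌊_⌋)
open import Relation.Binary.PropositionalEquality using (_≡_)
open import Algebra.Bundles using (CommutativeRing)

Adj : ℕ → Set
Adj n = Fin n → Fin n → Bool

Simple : ∀ {n} → Adj n → Set
Simple {n} G = (∀ (i j : Fin n) → G i j ≡ G j i) × (∀ (i : Fin n) → G i i ≡ false)

_==_ : ∀ {n} → Fin n → Fin n → Bool
i == j = ⌊ i ≟ j ⌋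

deleteEdge : ∀ {n} → Adj n → Fin n → Fin n → Adj n
deleteEdge G u v i j = G i j ∧ not ((i == u ∧ j == v) ∨ (i == v ∧ j == u))

anyFin : ∀ {n} → (Fin n → Bool) → Bool
anyFin {zero} p = false
anyFin {suc n} p = p zero ∨ anyFin (λ i → p (suc i))

countFin : ∀ {n} → (Fin n → Bool) → ℕ
countFin {zero} p = 0
countFin {suc n} p = (if p zero then 1 else 0) Data.Nat.+ countFin (λ i → p (suc i))

Subset : ℕ → Set
Subset n = Fin n → Bool

cons : ∀ {n} → Bool → Subset n → Subset (suc n)
cons b W zero = b
cons b W (suc i) = W i

allSubsets : (n : ℕ) → List (Subset n)
allSubsets zero = (λ ()) ∷ []
allSubsets (suc n) = concatMap (λ W → cons false W ∷ cons true W ∷ []) (allSubsets n)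

closedNbhd : ∀ {n} → Adj n → Subset n → Subset n
closedNbhd H W j = W j ∨ anyFin (λ i → W i ∧ H i j)

card : ∀ {n} → Subset n → ℕ
card = countFin

openNbhdSize : ∀ {n} → Adj n → Subset n → ℕ
openNbhdSize H W = countFin (λ j → closedNbhd H W j ∧ not (W j))

reachIn : ∀ {n} → Adj n → ℕ → Fin n → Subset n
reachIn H zero i j = i == j
reachIn H (suc k) i j = closedNbhd H (reachIn H k i) j

connected : ∀ {n} → Adj n → Fin n → Fin n → Bool
connected {n} H i j = reachIn H n i j

-- number of components = number of vertices that are the least
-- (in the order of Fin n) vertex of their component
_<ᶠ_ : ∀ {n} → Fin n → Fin n → Bool
i <ᶠ j = ⌊ Data.Nat._<?_ (Data.Fin.toℕ i) (Data.Fin.toℕ j) ⌋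

numComponents : ∀ {n} → Adj n → ℕ
numComponents H = countFin (λ i → not (anyFin (λ j → (j <ᶠ i) ∧ connected H i j)))

IsCutEdge : ∀ {n} → Adj n → Fin n → Fin n → Set
IsCutEdge G u v = (G u v ≡ true) × (numComponents G < numComponents (deleteEdge G u v))

module _ {c ℓ : Level} (R : CommutativeRing c ℓ) where
  open CommutativeRing R

  pow : Carrier → ℕ → Carrier
  pow a zero = 1#
  pow a (suc k) = a * pow a k

  Jc : ∀ {n} → Adj n → (Subset n → Bool) → Carrier → Carrier → Carrier
  Jc {n} H cond x y =
    foldr _+_ 0# (map (λ W → pow x (card W) * pow y (openNbhdSize H W))
                      (filterᵇ cond (allSubsets n)))

  J : ∀ {n} → Adj n → Carrier → Carrier → Carrier
  J H x y = Jc H (λ _ → true) x y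

condIn-notNbhd : ∀ {n} → Adj n → Fin n → Fin n → Subset n → Bool
condIn-notNbhd H a b W = W a ∧ not (anyFin (λ j → ((j == b) ∨ H b j) ∧ W j))

module Submission where

-- Write H = G - uv.  Since uv is an edge of G, adjacency in G is adjacency in
-- H together with the pair {u, v}.  Hence for every W the closed neighbourhood
-- N_G[W] is N_H[W] with v added when u ∈ W and with u added when v ∈ W.  The
-- open neighbourhood therefore gains v exactly when c₁(W) : u ∈ W, v ∉ N_H[W],
-- and gains u exactly when c₂(W) : v ∈ W, u ∉ N_H[W]; these conditions are
-- disjoint, and they are the conditions of the two restricted polynomials.
-- So |N_G(W)| = [c₁ W] + [c₂ W] + |N_H(W)|, each satisfied condition
-- multiplies the summand x^|W| y^|N_H(W)| by y = 1 + (y - 1), and summing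
-- over all W gives the formula.

open import Defs
open import Level using (Level)
open import Function using (_∘_)
open import Data.Nat using (ℕ; zero; suc)
import Data.Nat as ℕ
import Data.Nat.Properties as ℕₚ
open import Data.Bool using (Bool; true; false; _∧_; _∨_; not; if_then_else_)
open import Data.Bool.Properties
  using (∨-identityʳ; ∧-zeroʳ; ∨-assoc; ∨-comm; ∧-assoc; ∧-comm; ∧-distribˡ-∨; ∧-distribʳ-∨; ∨-commutativeMonoid)
open import Data.Fin using (Fin; zero; suc)
open import Data.Fin.Properties using (_≟_; suc-injective)
open import Data.List using (List; []; _∷_; map; filterᵇ; foldr)
open import Data.Product using (_,_)
open import Data.Empty using (⊥-elim)
open import Relation.Nullary using (yes; no; ¬_)
open import Relation.Nullary.Decidable using (⌊⌋-map′)
open import Relation.Binary.PropositionalEquality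
  using (_≡_; refl; sym; trans; cong; cong₂; subst; module ≡-Reasoning)
open import Algebra.Bundles using (CommutativeRing; CommutativeMonoid)
import Algebra.Properties.CommutativeSemigroup as CommSemigroupProps
import Algebra.Properties.Ring as RingProps
import Relation.Binary.Reasoning.Setoid as SetoidReasoning

-- 1. Boolean quantifiers and counting over Fin n

ind : Bool → ℕ
ind b = if b then 1 else 0

==-suc : ∀ {n} (i j : Fin n) → (suc i == suc j) ≡ (i == j)
==-suc i j = ⌊⌋-map′ (cong suc) suc-injective (i ≟ j)

anyFin-cong : ∀ {n} {p q : Fin n → Bool} → (∀ i → p i ≡ q i) → anyFin p ≡ anyFin q
anyFin-cong {zero} _ = refl
anyFin-cong {suc n} e = cong₂ _∨_ (e zero) (anyFin-cong (e ∘ suc))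

anyFin-∨ : ∀ {n} (p q : Fin n → Bool) → anyFin (λ i → p i ∨ q i) ≡ anyFin p ∨ anyFin q
anyFin-∨ {zero} p q = refl
anyFin-∨ {suc n} p q =
  trans (cong ((p zero ∨ q zero) ∨_) (anyFin-∨ (p ∘ suc) (q ∘ suc)))
        (interchange (p zero) (q zero) (anyFin (p ∘ suc)) (anyFin (q ∘ suc)))
  where open CommSemigroupProps (CommutativeMonoid.commutativeSemigroup ∨-commutativeMonoid)

anyFin-false : ∀ {n} → anyFin {n} (λ _ → false) ≡ false
anyFin-false {zero} = refl
anyFin-false {suc n} = anyFin-false {n}

anyFin-point : ∀ {n} (a : Fin n) (p : Fin n → Bool) → anyFin (λ i → (i == a) ∧ p i) ≡ p a
anyFin-point {suc n} zero p = trans (cong (p zero ∨_) (anyFin-false {n})) (∨-identityʳ (p zero))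
anyFin-point {suc n} (suc a) p =
  trans (anyFin-cong (λ i → cong (_∧ p (suc i)) (==-suc i a))) (anyFin-point a (p ∘ suc))

countFin-cong : ∀ {n} {p q : Fin n → Bool} → (∀ i → p i ≡ q i) → countFin p ≡ countFin q
countFin-cong {zero} _ = refl
countFin-cong {suc n} e = cong₂ ℕ._+_ (cong ind (e zero)) (countFin-cong (e ∘ suc))

countFin-+ : ∀ {n} {p q r : Fin n → Bool} → (∀ i → ind (p i) ≡ ind (q i) ℕ.+ ind (r i)) →
  countFin p ≡ countFin q ℕ.+ countFin r
countFin-+ {zero} _ = refl
countFin-+ {suc n} {q = q} {r} e =
  trans (cong₂ ℕ._+_ (e zero) (countFin-+ (e ∘ suc)))
        (interchange (ind (q zero)) (ind (r zero)) (countFin (q ∘ suc)) (countFin (r ∘ suc)))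
  where open CommSemigroupProps ℕₚ.+-commutativeSemigroup

countFin-false : ∀ {n} → countFin {n} (λ _ → false) ≡ 0
countFin-false {zero} = refl
countFin-false {suc n} = countFin-false {n}

countFin-point : ∀ {n} (a : Fin n) (p : Fin n → Bool) → countFin (λ i → (i == a) ∧ p i) ≡ ind (p a)
countFin-point {suc n} zero p = trans (cong (λ m → ind (p zero) ℕ.+ m) (countFin-false {n})) (ℕₚ.+-identityʳ _)
countFin-point {suc n} (suc a) p =
  trans (countFin-cong (λ i → cong (_∧ p (suc i)) (==-suc i a))) (countFin-point a (p ∘ suc))

-- 2. Deleting an edge: closed and open neighbourhoods

Symmetric : ∀ {n} → Adj n → Set
Symmetric {n} H = ∀ (i j : Fin n) → H i j ≡ H j i

isEdge : ∀ {n} → Fin n → Fin n → Fin n → Fin n → Bool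
isEdge u v i j = (i == u ∧ j == v) ∨ (i == v ∧ j == u)

isEdge-sym : ∀ {n} (u v i j : Fin n) → isEdge u v i j ≡ isEdge u v j i
isEdge-sym u v i j =
  trans (cong₂ _∨_ (∧-comm (i == u) (j == v)) (∧-comm (i == v) (j == u)))
        (∨-comm (j == v ∧ i == u) (j == u ∧ i == v))

deleteEdge-sym : ∀ {n} {G : Adj n} → Symmetric G → (u v : Fin n) → Symmetric (deleteEdge G u v)
deleteEdge-sym G-sym u v i j = cong₂ (λ g e → g ∧ not e) (G-sym i j) (isEdge-sym u v i j)

edge-endpoints-distinct : ∀ {n} {G : Adj n} → (∀ i → G i i ≡ false) →
  {u v : Fin n} → G u v ≡ true → ¬ u ≡ v
edge-endpoints-distinct loopless {u} uv∈G refl with trans (sym uv∈G) (loopless u)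
... | ()

==-distinct : ∀ {n} {u v : Fin n} → ¬ u ≡ v → ∀ j → (j == v) ∧ (j == u) ≡ false
==-distinct {u = u} {v} u≢v j with j ≟ v | j ≟ u
... | yes refl | yes v≡u = ⊥-elim (u≢v (sym v≡u))
... | yes _ | no _ = refl
... | no _ | _ = refl

viaEdge : ∀ {n} → Fin n → Fin n → Subset n → Fin n → Bool
viaEdge u v W j = (j == v ∧ W u) ∨ (j == u ∧ W v)

anyFin-isEdge : ∀ {n} (u v : Fin n) (W : Subset n) j →
  anyFin (λ i → W i ∧ isEdge u v i j) ≡ viaEdge u v W j
anyFin-isEdge u v W j = begin
    anyFin (λ i → W i ∧ isEdge u v i j)
  ≡⟨ anyFin-cong (λ i → ∧-distribˡ-∨ (W i) (i == u ∧ j == v) (i == v ∧ j == u)) ⟩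
    anyFin (λ i → (W i ∧ (i == u ∧ j == v)) ∨ (W i ∧ (i == v ∧ j == u)))
  ≡⟨ anyFin-∨ (λ i → W i ∧ (i == u ∧ j == v)) (λ i → W i ∧ (i == v ∧ j == u)) ⟩
    anyFin (λ i → W i ∧ (i == u ∧ j == v)) ∨ anyFin (λ i → W i ∧ (i == v ∧ j == u))
  ≡⟨ cong₂ _∨_ (from-endpoint u v) (from-endpoint v u) ⟩
    viaEdge u v W j
  ∎
  where
  open ≡-Reasoning
  rotate : ∀ w a b → w ∧ (a ∧ b) ≡ a ∧ (b ∧ w)
  rotate w a b = trans (∧-comm w (a ∧ b)) (∧-assoc a b w)
  from-endpoint : ∀ a b → anyFin (λ i → W i ∧ (i == a ∧ j == b)) ≡ (j == b ∧ W a)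
  from-endpoint a b =
    trans (anyFin-cong (λ i → rotate (W i) (i == a) (j == b))) (anyFin-point a (λ i → j == b ∧ W i))

module EdgeDeletion {n} (G : Adj n) (G-sym : Symmetric G) (u v : Fin n) (uv∈G : G u v ≡ true) where

  H : Adj n
  H = deleteEdge G u v

  reversed⇒adjacent : ∀ i j → (i == v ∧ j == u) ≡ true → G i j ≡ true
  reversed⇒adjacent i j e with i ≟ v | j ≟ u
  reversed⇒adjacent _ _ _ | yes refl | yes refl = trans (G-sym v u) uv∈G
  reversed⇒adjacent _ _ () | yes _ | no _
  reversed⇒adjacent _ _ () | no _ | _

  isEdge⇒adjacent : ∀ i j → isEdge u v i j ≡ true → G i j ≡ true
  isEdge⇒adjacent i j e with i ≟ u | j ≟ v
  ... | yes refl | yes refl = uv∈G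
  ... | yes _ | no _ = reversed⇒adjacent i j e
  ... | no _ | _ = reversed⇒adjacent i j e

  adjacency-split : ∀ i j → G i j ≡ H i j ∨ isEdge u v i j
  adjacency-split i j = restore (G i j) (isEdge u v i j) (isEdge⇒adjacent i j)
    where
    restore : ∀ g e → (e ≡ true → g ≡ true) → g ≡ (g ∧ not e) ∨ e
    restore true true _ = refl
    restore false true e⇒g = e⇒g refl
    restore true false _ = refl
    restore false false _ = refl

  closedNbhd-split : ∀ (W : Subset n) j → closedNbhd G W j ≡ closedNbhd H W j ∨ viaEdge u v W j
  closedNbhd-split W j = begin
      W j ∨ anyFin (λ i → W i ∧ G i j)
    ≡⟨ cong (W j ∨_) (anyFin-cong (λ i → trans (cong (W i ∧_) (adjacency-split i j))
                                                (∧-distribˡ-∨ (W i) (H i j) (isEdge u v i j)))) ⟩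
      W j ∨ anyFin (λ i → (W i ∧ H i j) ∨ (W i ∧ isEdge u v i j))
    ≡⟨ cong (W j ∨_) (anyFin-∨ (λ i → W i ∧ H i j) (λ i → W i ∧ isEdge u v i j)) ⟩
      W j ∨ (anyFin (λ i → W i ∧ H i j) ∨ anyFin (λ i → W i ∧ isEdge u v i j))
    ≡⟨ cong (λ t → W j ∨ (anyFin (λ i → W i ∧ H i j) ∨ t)) (anyFin-isEdge u v W j) ⟩
      W j ∨ (anyFin (λ i → W i ∧ H i j) ∨ viaEdge u v W j)
    ≡⟨ sym (∨-assoc (W j) _ _) ⟩
      closedNbhd H W j ∨ viaEdge u v W j
    ∎
    where open ≡-Reasoning

condIn-notNbhd-closed : ∀ {n} {H : Adj n} → Symmetric H → (a b : Fin n) (W : Subset n) →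
  condIn-notNbhd H a b W ≡ W a ∧ not (closedNbhd H W b)
condIn-notNbhd-closed {H = H} H-sym a b W = cong (λ z → W a ∧ not z) (begin
    anyFin (λ j → ((j == b) ∨ H b j) ∧ W j)
  ≡⟨ anyFin-cong (λ j → trans (∧-distribʳ-∨ (W j) (j == b) (H b j))
                              (cong ((j == b ∧ W j) ∨_)
                                    (trans (∧-comm (H b j) (W j)) (cong (W j ∧_) (H-sym b j))))) ⟩
    anyFin (λ j → (j == b ∧ W j) ∨ (W j ∧ H j b))
  ≡⟨ anyFin-∨ (λ j → j == b ∧ W j) (λ j → W j ∧ H j b) ⟩
    anyFin (λ j → j == b ∧ W j) ∨ anyFin (λ j → W j ∧ H j b)
  ≡⟨ cong (_∨ anyFin (λ j → W j ∧ H j b)) (anyFin-point b W) ⟩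
    closedNbhd H W b
  ∎)
  where open ≡-Reasoning

openNbhdSize-grow : ∀ {n} (G H : Adj n) (W B : Subset n) →
  (∀ j → closedNbhd G W j ≡ closedNbhd H W j ∨ B j) →
  openNbhdSize G W ≡ countFin (λ j → B j ∧ not (closedNbhd H W j)) ℕ.+ openNbhdSize H W
openNbhdSize-grow G H W B split =
  trans (countFin-cong (λ j → cong (_∧ not (W j)) (split j)))
        (countFin-+ (λ j → grow (closedNbhd H W j) (B j) (W j) (in-own-closedNbhd j)))
  where
  in-own-closedNbhd : ∀ j → W j ≡ true → closedNbhd H W j ≡ true
  in-own-closedNbhd j w = subst (λ t → t ∨ anyFin (λ i → W i ∧ H i j) ≡ true) (sym w) refl
  grow : ∀ a b w → (w ≡ true → a ≡ true) → ind ((a ∨ b) ∧ not w) ≡ ind (b ∧ not a) ℕ.+ ind (a ∧ not w)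
  grow true true true _ = refl
  grow true false true _ = refl
  grow false b true w⇒a with w⇒a refl
  ... | ()
  grow true true false _ = refl
  grow true false false _ = refl
  grow false true false _ = refl
  grow false false false _ = refl

-- Of the two candidates v (if u ∈ W) and u (if v ∈ W), count those outside N;
-- the candidates are different vertices because u ≠ v.
countFin-viaEdge : ∀ {n} {u v : Fin n} → ¬ u ≡ v → (W N : Subset n) →
  countFin (λ j → viaEdge u v W j ∧ not (N j)) ≡ ind (W u ∧ not (N v)) ℕ.+ ind (W v ∧ not (N u))
countFin-viaEdge {u = u} {v} u≢v W N = begin
    countFin (λ j → viaEdge u v W j ∧ not (N j))
  ≡⟨ countFin-+ split ⟩
    countFin (λ j → (j == v ∧ W u) ∧ not (N j)) ℕ.+ countFin (λ j → (j == u ∧ W v) ∧ not (N j))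
  ≡⟨ cong₂ ℕ._+_ (candidate v (W u)) (candidate u (W v)) ⟩
    ind (W u ∧ not (N v)) ℕ.+ ind (W v ∧ not (N u))
  ∎
  where
  open ≡-Reasoning
  disjoint-sum : ∀ a b → a ∧ b ≡ false → ind (a ∨ b) ≡ ind a ℕ.+ ind b
  disjoint-sum true true ()
  disjoint-sum true false _ = refl
  disjoint-sum false b _ = refl
  separate : ∀ s t p q r → s ∧ t ≡ false → ((s ∧ p) ∧ r) ∧ ((t ∧ q) ∧ r) ≡ false
  separate true true p q r ()
  separate true false p q r _ = ∧-zeroʳ (p ∧ r)
  separate false t p q r _ = refl
  split : ∀ j → ind (viaEdge u v W j ∧ not (N j))
                ≡ ind ((j == v ∧ W u) ∧ not (N j)) ℕ.+ ind ((j == u ∧ W v) ∧ not (N j))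
  split j = trans (cong ind (∧-distribʳ-∨ (not (N j)) (j == v ∧ W u) (j == u ∧ W v)))
                  (disjoint-sum ((j == v ∧ W u) ∧ not (N j)) ((j == u ∧ W v) ∧ not (N j))
                                (separate (j == v) (j == u) (W u) (W v) (not (N j)) (==-distinct u≢v j)))
  candidate : ∀ a w → countFin (λ j → (j == a ∧ w) ∧ not (N j)) ≡ ind (w ∧ not (N a))
  candidate a w = trans (countFin-cong (λ j → ∧-assoc (j == a) w (not (N j)))) (countFin-point a (λ j → w ∧ not (N j)))

openNbhdSize-deleteEdge : ∀ {n} (G : Adj n) → Simple G → (u v : Fin n) → G u v ≡ true → (W : Subset n) →
  openNbhdSize G W
    ≡ ind (condIn-notNbhd (deleteEdge G u v) u v W) ℕ.+ ind (condIn-notNbhd (deleteEdge G u v) v u W)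
      ℕ.+ openNbhdSize (deleteEdge G u v) W
openNbhdSize-deleteEdge G (G-sym , loopless) u v uv∈G W = begin
    openNbhdSize G W
  ≡⟨ openNbhdSize-grow G H W (viaEdge u v W) (closedNbhd-split W) ⟩
    countFin (λ j → viaEdge u v W j ∧ not (closedNbhd H W j)) ℕ.+ openNbhdSize H W
  ≡⟨ cong (λ m → m ℕ.+ openNbhdSize H W)
       (countFin-viaEdge (edge-endpoints-distinct loopless uv∈G) W (closedNbhd H W)) ⟩
    ind (W u ∧ not (closedNbhd H W v)) ℕ.+ ind (W v ∧ not (closedNbhd H W u)) ℕ.+ openNbhdSize H W
  ≡⟨ sym (cong₂ (λ a b → ind a ℕ.+ ind b ℕ.+ openNbhdSize H W)
                 (condIn-notNbhd-closed H-sym u v W) (condIn-notNbhd-closed H-sym v u W)) ⟩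
    ind (condIn-notNbhd H u v W) ℕ.+ ind (condIn-notNbhd H v u W) ℕ.+ openNbhdSize H W
  ∎
  where
  open ≡-Reasoning
  open EdgeDeletion G G-sym u v uv∈G
  H-sym : Symmetric H
  H-sym = deleteEdge-sym G-sym u v

-- c₁ and c₂ exclude each other: u ∈ W forces u ∈ N_H[W].
conditions-disjoint : ∀ {n} {H : Adj n} → Symmetric H → (u v : Fin n) (W : Subset n) →
  condIn-notNbhd H u v W ∧ condIn-notNbhd H v u W ≡ false
conditions-disjoint {H = H} H-sym u v W
  rewrite condIn-notNbhd-closed H-sym u v W | condIn-notNbhd-closed H-sym v u W
  = exclusive (W u) (W v) (anyFin (λ i → W i ∧ H i v)) (anyFin (λ i → W i ∧ H i u))
  where
  exclusive : ∀ a b x y → (a ∧ not (b ∨ x)) ∧ (b ∧ not (a ∨ y)) ≡ false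
  exclusive true true x y = refl
  exclusive true false true y = refl
  exclusive true false false y = refl
  exclusive false b x y = refl

-- 3. Sums over lists in a commutative ring

module RingSums {c ℓ : Level} (R : CommutativeRing c ℓ) where
  open CommutativeRing R renaming (refl to ≈-refl; sym to ≈-sym; trans to ≈-trans)
  open SetoidReasoning setoid

  sumList : ∀ {A : Set} → List A → (A → Carrier) → Carrier
  sumList L g = foldr _+_ 0# (map g L)

  indicator : Bool → Carrier → Carrier
  indicator b z = if b then z else 0#

  sum-filter : ∀ {A : Set} (cond : A → Bool) (f : A → Carrier) (L : List A) →
    foldr _+_ 0# (map f (filterᵇ cond L)) ≈ sumList L (λ a → indicator (cond a) (f a))
  sum-filter cond f [] = ≈-refl
  sum-filter cond f (a ∷ L) with cond a
  ... | true = +-congˡ (sum-filter cond f L)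
  ... | false = ≈-trans (sum-filter cond f L) (≈-sym (+-identityˡ _))

  sum-cong : ∀ {A : Set} (L : List A) {f g : A → Carrier} → (∀ a → f a ≈ g a) → sumList L f ≈ sumList L g
  sum-cong [] _ = ≈-refl
  sum-cong (a ∷ L) e = +-cong (e a) (sum-cong L e)

  sum-linear : ∀ {A : Set} (L : List A) (f g : A → Carrier) (k : Carrier) →
    sumList L (λ a → f a + k * g a) ≈ sumList L f + k * sumList L g
  sum-linear [] f g k = ≈-sym (≈-trans (+-congˡ (zeroʳ k)) (+-identityʳ 0#))
  sum-linear (a ∷ L) f g k = begin
      (f a + k * g a) + sumList L (λ b → f b + k * g b)
    ≈⟨ +-congˡ (sum-linear L f g k) ⟩
      (f a + k * g a) + (sumList L f + k * sumList L g)
    ≈⟨ interchange (f a) (k * g a) (sumList L f) (k * sumList L g) ⟩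
      (f a + sumList L f) + (k * g a + k * sumList L g)
    ≈⟨ +-congˡ (≈-sym (distribˡ k (g a) (sumList L g))) ⟩
      (f a + sumList L f) + k * (g a + sumList L g)
    ∎
    where open CommSemigroupProps +-commutativeSemigroup using (interchange)

  extra-factor : ∀ y z p → z * (y * p) ≈ z * p + (y - 1#) * (z * p)
  extra-factor y z p = begin
      z * (y * p)
    ≈⟨ x∙yz≈y∙xz z y p ⟩
      y * (z * p)
    ≈⟨ ≈-sym (+-identityʳ _) ⟩
      y * (z * p) + 0#
    ≈⟨ +-congˡ (≈-sym (-‿inverseʳ (z * p))) ⟩
      y * (z * p) + (z * p - z * p)
    ≈⟨ +-congˡ (+-congˡ (≈-sym (-1*x≈-x (z * p)))) ⟩
      y * (z * p) + (z * p + - 1# * (z * p))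
    ≈⟨ x∙yz≈y∙xz′ (y * (z * p)) (z * p) _ ⟩
      z * p + (y * (z * p) + - 1# * (z * p))
    ≈⟨ +-congˡ (≈-sym (distribʳ (z * p) y (- 1#))) ⟩
      z * p + (y - 1#) * (z * p)
    ∎
    where
    open CommSemigroupProps *-commutativeSemigroup using (x∙yz≈y∙xz)
    open CommSemigroupProps +-commutativeSemigroup renaming (x∙yz≈y∙xz to x∙yz≈y∙xz′)
    open RingProps ring using (-1*x≈-x)

  ≈+k·0 : ∀ {a} k → a ≈ a + k * 0#
  ≈+k·0 k = ≈-sym (≈-trans (+-congˡ (zeroʳ k)) (+-identityʳ _))

  weight-split : ∀ (y z : Carrier) (m : ℕ) (b₁ b₂ : Bool) → b₁ ∧ b₂ ≡ false →
    z * pow R y (ind b₁ ℕ.+ ind b₂ ℕ.+ m)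
      ≈ z * pow R y m + (y - 1#) * indicator b₁ (z * pow R y m) + (y - 1#) * indicator b₂ (z * pow R y m)
  weight-split y z m true true ()
  weight-split y z m true false _ = ≈-trans (extra-factor y z (pow R y m)) (≈+k·0 (y - 1#))
  weight-split y z m false true _ = ≈-trans (extra-factor y z (pow R y m)) (+-congʳ (≈+k·0 (y - 1#)))
  weight-split y z m false false _ = ≈-trans (≈+k·0 (y - 1#)) (≈+k·0 (y - 1#))

lemma6 : ∀ {c ℓ} (R : CommutativeRing c ℓ) → let open CommutativeRing R in
    ∀ (n : ℕ) (G : Adj n) → Simple G → (u v : Fin n) → IsCutEdge G u v →
    ∀ (x y : Carrier) →
      J R G x y ≈ (J R (deleteEdge G u v) x y
        + (y - 1#) * Jc R (deleteEdge G u v) (condIn-notNbhd (deleteEdge G u v) u v) x y)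
        + (y - 1#) * Jc R (deleteEdge G u v) (condIn-notNbhd (deleteEdge G u v) v u) x y
lemma6 R n G simple@(G-sym , _) u v (uv∈G , _) x y = begin
    J R G x y
  ≈⟨ sum-filter (λ _ → true) (term G) L ⟩
    sumList L (term G)
  ≈⟨ sum-cong L term-split ⟩
    sumList L (λ W → (term H W + k * restricted c₁ W) + k * restricted c₂ W)
  ≈⟨ ≈-trans (sum-linear L _ (restricted c₂) k) (+-congʳ (sum-linear L (term H) (restricted c₁) k)) ⟩
    sumList L (term H) + k * sumList L (restricted c₁) + k * sumList L (restricted c₂)
  ≈⟨ ≈-sym (+-cong (+-cong (sum-filter (λ _ → true) (term H) L) (*-congˡ (sum-filter c₁ (term H) L)))
                 (*-congˡ (sum-filter c₂ (term H) L))) ⟩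
    J R H x y + k * Jc R H c₁ x y + k * Jc R H c₂ x y
  ∎
  where
  open CommutativeRing R renaming (refl to ≈-refl; sym to ≈-sym; trans to ≈-trans)
  open SetoidReasoning setoid
  open RingSums R
  H : Adj n
  H = deleteEdge G u v
  L : List (Subset n)
  L = allSubsets n
  k : Carrier
  k = y - 1#
  c₁ c₂ : Subset n → Bool
  c₁ = condIn-notNbhd H u v
  c₂ = condIn-notNbhd H v u
  term : Adj n → Subset n → Carrier
  term K W = pow R x (card W) * pow R y (openNbhdSize K W)
  restricted : (Subset n → Bool) → Subset n → Carrier
  restricted cond W = indicator (cond W) (term H W)
  term-split : ∀ W → term G W ≈ (term H W + k * restricted c₁ W) + k * restricted c₂ W
  term-split W =
    ≈-trans (reflexive (cong (λ m → pow R x (card W) * pow R y m) (openNbhdSize-deleteEdge G simple u v uv∈G W)))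
            (weight-split y (pow R x (card W)) (openNbhdSize H W) (c₁ W) (c₂ W)
                          (conditions-disjoint (deleteEdge-sym G-sym u v) u v W))
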